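{- Let $r\ge 2$ and $n\ge3$. Let $\lambda$ be the word morphism on the alphabet $\{E,N\}$ given by $E\mapsto E^{r-1}N$, $N\mapsto E^{r-2}N$, and let $\theta$ be the morphism $E\mapsto E$, $N\mapsto EN$. Then applying $\lambda$ to the Christoffel word of $\mathcal{D}_n$ yields the Christoffel word of $\mathcal{D}_{n+1}$, and applying $\theta\circ\lambda\circ\theta^{ -1}$ to the Christoffel word of $\mathcal{C}_n$ yields the Christoffel word of $\mathcal{C}_{n+1}$.
   Context: Define integers $c_1=0$, $c_2=1$, $c_n=rc_{n-1}-c_{n-2}$ for $n\ge 3$. For coprime nonnegative integers $a,b$, the maximal Dyck path $\mathcal{P}(a,b)$ is the lattice path from $(0,0)$ to $(a,b)$ using unit north and east steps that never passes strictly above the segment from $(0,0)$ to $(a,b)$ and whose height at each vertex is maximal among such paths. For $n\ge 3$, $\mathcal{C}_n=\mathcal{P}(c_{n-1},c_{n-2})$ and $\mathcal{D}_n=\mathcal{P}(c_{n-1}-c_{n-2},c_{n-2})$. The Christoffel word of a maximal Dyck path is the word in $\{E,N\}$ obtained by reading its steps from $(0,0)$, writing $E$ for an east step and $N$ for a north step. The Christoffel word of $\mathcal{C}_n$ is $\theta$ applied to that of $\mathcal{D}_n$, so $\theta^{ -1}$ is defined on it. -}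

module Defs where

open import Data.Nat using (ℕ; zero; suc; _+_; _*_; _∸_; _≤_)
open import Data.List using (List; []; _∷_; _++_; take; replicate; concatMap)
open import Data.Product using (_×_)
open import Relation.Binary.PropositionalEquality using (_≡_)

-- The sequence c_n (parameter r), indexed from 1: c r 1 = 0, c r 2 = 1,
-- c r n = r * c r (n-1) - c r (n-2) for n ≥ 3.  (Index 0 is a dummy value.)
-- Truncated subtraction is harmless: for r ≥ 2 the sequence is
-- nondecreasing, so r * c(n-1) ≥ c(n-2).
c : ℕ → ℕ → ℕ
c r zero = 0
c r (suc zero) = 0
c r (suc (suc zero)) = 1
c r (suc (suc (suc n))) = r * c r (suc (suc n)) ∸ c r (suc n)

data Letter : Set where
  E N : Letter

Word : Set
Word = List Letter

countE : Word → ℕ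
countE [] = 0
countE (E ∷ w) = suc (countE w)
countE (N ∷ w) = countE w

countN : Word → ℕ
countN [] = 0
countN (E ∷ w) = countN w
countN (N ∷ w) = suc (countN w)

-- A lattice path from (0,0) to (a,b) using unit E/N steps, encoded by the
-- word of its steps read from (0,0).
IsPath : ℕ → ℕ → Word → Set
IsPath a b w = (countE w ≡ a) × (countN w ≡ b)

NotAbove : ℕ → ℕ → Word → Set
NotAbove a b w = ∀ i → countN (take i w) * a ≤ countE (take i w) * b

height : Word → ℕ → ℕ
height w i = countN (take i w)

-- w is (the Christoffel word of) the maximal Dyck path P(a,b): an admissible
-- path whose height at each vertex is maximal among all admissible paths.
IsMaxDyck : ℕ → ℕ → Word → Set
IsMaxDyck a b w =
  IsPath a b w × NotAbove a b w ×
  (∀ w' → IsPath a b w' → NotAbove a b w' → ∀ i → height w' i ≤ height w i)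

lamLetter : ℕ → Letter → Word
lamLetter r E = replicate (r ∸ 1) E ++ (N ∷ [])
lamLetter r N = replicate (r ∸ 2) E ++ (N ∷ [])

lam : ℕ → Word → Word
lam r = concatMap (lamLetter r)

thetaLetter : Letter → Word
thetaLetter E = E ∷ []
thetaLetter N = E ∷ N ∷ []

theta : Word → Word
theta = concatMap thetaLetter

-- A Christoffel word is produced greedily: keeping the residue d = x·b − y·a of the
-- current vertex (x, y), step E while d < a and N otherwise. Such a word stays below
-- the diagonal, and since every vertex of it has d < a + b, an admissible path that
-- is higher after the same number of steps would have to cross the diagonal; so the
-- greedy word is the maximal Dyck path. Both λ and θ send greedy words to greedy
-- words (for the widths and heights predicted by the recurrence for c), and the
-- theorem follows from uniqueness of maximal Dyck paths and injectivity of θ.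
module Submission where

open import Defs
open import Data.Nat using (ℕ; zero; suc; _+_; _*_; _∸_; _≤_; _<_; _⊓_; s≤s; z≤n)
open import Data.Nat.Properties
open import Data.Nat.Tactic.RingSolver using (solve-∀)
open import Algebra.Properties.CommutativeSemigroup +-commutativeSemigroup using (xy∙z≈xz∙y)
open import Data.List using ([]; _∷_; _++_; take; replicate; length)
open import Data.List.Properties using (length-take; ∷-injectiveʳ; ++-assoc)
open import Data.Product using (_×_; _,_; proj₁; proj₂; ∃-syntax)
open import Data.Empty using (⊥-elim)
open import Relation.Binary.PropositionalEquality using (_≡_; refl; sym; trans; cong; cong₂; subst; subst₂; _≢_; module ≡-Reasoning)

length≡countE+countN : ∀ w → length w ≡ countE w + countN w
length≡countE+countN []      = refl
length≡countE+countN (E ∷ w) = cong suc (length≡countE+countN w)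
length≡countE+countN (N ∷ w) = trans (cong suc (length≡countE+countN w)) (sym (+-suc _ _))

countE-++ : ∀ u v → countE (u ++ v) ≡ countE u + countE v
countE-++ []      v = refl
countE-++ (E ∷ u) v = cong suc (countE-++ u v)
countE-++ (N ∷ u) v = countE-++ u v

countN-++ : ∀ u v → countN (u ++ v) ≡ countN u + countN v
countN-++ []      v = refl
countN-++ (E ∷ u) v = countN-++ u v
countN-++ (N ∷ u) v = cong suc (countN-++ u v)

countE-Eᵏ-N : ∀ k → countE (replicate k E ++ N ∷ []) ≡ k
countE-Eᵏ-N zero    = refl
countE-Eᵏ-N (suc k) = cong suc (countE-Eᵏ-N k)

countN-Eᵏ-N : ∀ k → countN (replicate k E ++ N ∷ []) ≡ 1
countN-Eᵏ-N zero    = refl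
countN-Eᵏ-N (suc k) = countN-Eᵏ-N k

countE-lam : ∀ s w → countE (lam (2 + s) w) ≡ suc s * countE w + s * countN w
countE-lam s []      = sym (cong₂ _+_ (*-zeroʳ (suc s)) (*-zeroʳ s))
countE-lam s (E ∷ w) =
  trans (countE-++ (lamLetter (2 + s) E) (lam (2 + s) w))
        (trans (cong₂ _+_ (countE-Eᵏ-N (suc s)) (countE-lam s w)) (identity s _ _))
  where
  identity : ∀ s x y → suc s + (suc s * x + s * y) ≡ suc s * suc x + s * y
  identity = solve-∀
countE-lam s (N ∷ w) =
  trans (countE-++ (lamLetter (2 + s) N) (lam (2 + s) w))
        (trans (cong₂ _+_ (countE-Eᵏ-N s) (countE-lam s w)) (identity s _ _))
  where
  identity : ∀ s x y → s + (suc s * x + s * y) ≡ suc s * x + s * suc y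
  identity = solve-∀

countN-lam : ∀ s w → countN (lam (2 + s) w) ≡ countE w + countN w
countN-lam s []      = refl
countN-lam s (E ∷ w) =
  trans (countN-++ (lamLetter (2 + s) E) (lam (2 + s) w))
        (cong₂ _+_ (countN-Eᵏ-N (suc s)) (countN-lam s w))
countN-lam s (N ∷ w) =
  trans (countN-++ (lamLetter (2 + s) N) (lam (2 + s) w))
        (trans (cong₂ _+_ (countN-Eᵏ-N s) (countN-lam s w)) (sym (+-suc _ _)))

countE-theta : ∀ w → countE (theta w) ≡ countE w + countN w
countE-theta []      = refl
countE-theta (E ∷ w) = cong suc (countE-theta w)
countE-theta (N ∷ w) = trans (cong suc (countE-theta w)) (sym (+-suc _ _))

countN-theta : ∀ w → countN (theta w) ≡ countN w
countN-theta []      = refl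
countN-theta (E ∷ w) = countN-theta w
countN-theta (N ∷ w) = cong suc (countN-theta w)

isPath-lam : ∀ s {a b} w → IsPath a b w → IsPath (suc s * a + s * b) (a + b) (lam (2 + s) w)
isPath-lam s w (refl , refl) = countE-lam s w , countN-lam s w

isPath-theta : ∀ {a b} w → IsPath a b w → IsPath (a + b) b (theta w)
isPath-theta w (refl , refl) = countE-theta w , countN-theta w

countE+countN-take : ∀ {a b w} → IsPath a b w → ∀ i →
  countE (take i w) + countN (take i w) ≡ i ⊓ (a + b)
countE+countN-take {w = w} (refl , refl) i = begin
  countE (take i w) + countN (take i w) ≡⟨ sym (length≡countE+countN (take i w)) ⟩
  length (take i w)                     ≡⟨ length-take i w ⟩
  i ⊓ length w                          ≡⟨ cong (i ⊓_) (length≡countE+countN w) ⟩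
  i ⊓ (countE w + countN w)             ∎
  where open ≡-Reasoning

height-injective : ∀ w v → length w ≡ length v → (∀ i → height w i ≡ height v i) → w ≡ v
height-injective []      []      _ _ = refl
height-injective (E ∷ w) (E ∷ v) l h =
  cong (E ∷_) (height-injective w v (suc-injective l) (λ i → h (suc i)))
height-injective (N ∷ w) (N ∷ v) l h =
  cong (N ∷_) (height-injective w v (suc-injective l) (λ i → suc-injective (h (suc i))))
height-injective (E ∷ w) (N ∷ v) _ h with h 1
... | ()
height-injective (N ∷ w) (E ∷ v) _ h with h 1
... | ()

maxDyck-unique : ∀ {a b w v} → IsMaxDyck a b w → IsMaxDyck a b v → w ≡ v
maxDyck-unique {w = w} {v} (pw , nw , mw) (pv , nv , mv) =
  height-injective w v (trans (length-path w pw) (sym (length-path v pv)))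
    (λ i → ≤-antisym (mv w pw nw i) (mw v pv nv i))
  where
  length-path : ∀ {a b} u → IsPath a b u → length u ≡ a + b
  length-path u (refl , refl) = length≡countE+countN u

theta≢N∷ : ∀ u {w} → theta u ≢ N ∷ w
theta≢N∷ []      ()
theta≢N∷ (E ∷ u) ()
theta≢N∷ (N ∷ u) ()

theta-injective : ∀ u v → theta u ≡ theta v → u ≡ v
theta-injective []      []      _  = refl
theta-injective (E ∷ u) (E ∷ v) eq = cong (E ∷_) (theta-injective u v (∷-injectiveʳ eq))
theta-injective (N ∷ u) (N ∷ v) eq = cong (N ∷_) (theta-injective u v (∷-injectiveʳ (∷-injectiveʳ eq)))
theta-injective (E ∷ u) (N ∷ v) eq = ⊥-elim (theta≢N∷ u (∷-injectiveʳ eq))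
theta-injective (N ∷ u) (E ∷ v) eq = ⊥-elim (theta≢N∷ v (sym (∷-injectiveʳ eq)))
theta-injective []      (E ∷ v) ()
theta-injective []      (N ∷ v) ()
theta-injective (E ∷ u) []      ()
theta-injective (N ∷ u) []      ()

-- Started at d = 0, the residue after x east and
-- y north steps is x·b − y·a, the scaled distance of the vertex below the diagonal.
data Greedy (a b : ℕ) : ℕ → Word → Set where
  done  : ∀ {d} → Greedy a b d []
  east  : ∀ {d w} → d < a → Greedy a b (d + b) w → Greedy a b d (E ∷ w)
  north : ∀ {d w} → Greedy a b d w → Greedy a b (d + a) (N ∷ w)

north′ : ∀ {a b d e w} → d ≡ e + a → Greedy a b e w → Greedy a b d (N ∷ w)
north′ refl g = north g

east-run : ∀ {a b} k {d w} → d + k * b < a + b → Greedy a b (d + k * b) w →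
  Greedy a b d (replicate k E ++ w)
east-run {a} {b} zero    {d} {w} _ g = subst (λ e → Greedy a b e w) (+-identityʳ d) g
east-run {a} {b} (suc k) {d} {w} bound g =
  east (+-cancelʳ-< b d a (≤-<-trans (+-monoʳ-≤ d (m≤m+n b (k * b))) bound))
       (east-run k (subst (_< a + b) d+[b+kb] bound) (subst (λ e → Greedy a b e w) d+[b+kb] g))
  where
  d+[b+kb] : d + suc k * b ≡ d + b + k * b
  d+[b+kb] = sym (+-assoc d b (k * b))

greedy-residue : ∀ {a b d w} → d < a + b → Greedy a b d w → ∀ i →
  ∃[ e ] e < a + b × d + countE (take i w) * b ≡ e + countN (take i w) * a
greedy-residue {d = d} d< _    zero    = d , d< , refl
greedy-residue {d = d} d< done (suc i) = d , d< , refl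
greedy-residue {b = b} {d} _ (east d<a g) (suc i) with greedy-residue (+-monoˡ-< b d<a) g i
... | e , e< , eq = e , e< , trans (sym (+-assoc d b _)) eq
greedy-residue {a} {b} d+a< (north {d} {w} g) (suc i) with greedy-residue (m+n≤o⇒m≤o (suc d) d+a<) g i
... | e , e< , eq = e , e< , (begin
  d + a + x * b   ≡⟨ xy∙z≈xz∙y d a (x * b) ⟩
  d + x * b + a   ≡⟨ cong (_+ a) eq ⟩
  e + y * a + a   ≡⟨ +-assoc e (y * a) a ⟩
  e + (y * a + a) ≡⟨ cong (e +_) (+-comm (y * a) a) ⟩
  e + suc y * a   ∎)
  where
  open ≡-Reasoning
  x = countE (take i w)
  y = countN (take i w)

height-bound : ∀ {a b x y x′ y′} → x * b < (a + b) + y * a → y′ * a ≤ x′ * b →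
  x′ + y′ ≡ x + y → y′ ≤ y
height-bound {a} {b} {x} {y} {x′} {y′} xb< y′a≤x′b same =
  ≮⇒≥ λ y<y′ → <-irrefl refl (begin-strict
    suc y * (a + b)         ≤⟨ *-monoˡ-≤ (a + b) y<y′ ⟩
    y′ * (a + b)            ≡⟨ *-distribˡ-+ y′ a b ⟩
    y′ * a + y′ * b         ≤⟨ +-monoˡ-≤ (y′ * b) y′a≤x′b ⟩
    x′ * b + y′ * b         ≡⟨ sym (*-distribʳ-+ b x′ y′) ⟩
    (x′ + y′) * b           ≡⟨ cong (_* b) same ⟩
    (x + y) * b             ≡⟨ *-distribʳ-+ b x y ⟩
    x * b + y * b           <⟨ +-monoˡ-< (y * b) xb< ⟩
    a + b + y * a + y * b   ≡⟨ identity a b y ⟩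
    suc y * (a + b)         ∎)
  where
  open ≤-Reasoning
  identity : ∀ a b y → a + b + y * a + y * b ≡ suc y * (a + b)
  identity = solve-∀

greedy⇒maxDyck : ∀ {a b w} → 0 < a + b → IsPath a b w → Greedy a b 0 w → IsMaxDyck a b w
greedy⇒maxDyck {a} {b} {w} pos path g = path , notAbove , maximal
  where
  notAbove : NotAbove a b w
  notAbove i with greedy-residue pos g i
  ... | e , _ , eq = subst (countN (take i w) * a ≤_) (sym eq) (m≤n+m _ e)
  maximal : ∀ w′ → IsPath a b w′ → NotAbove a b w′ → ∀ i → height w′ i ≤ height w i
  maximal w′ path′ notAbove′ i with greedy-residue pos g i
  ... | e , e< , eq =
    height-bound (subst (_< a + b + y * a) (sym eq) (+-monoˡ-< (y * a) e<)) (notAbove′ i)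
      (trans (countE+countN-take path′ i) (sym (countE+countN-take path i)))
    where
    y = countN (take i w)

lam-E∷ : ∀ s w → lam (2 + s) (E ∷ w) ≡ replicate (suc s) E ++ N ∷ lam (2 + s) w
lam-E∷ s w = ++-assoc (replicate (suc s) E) (N ∷ []) (lam (2 + s) w)

lam-N∷ : ∀ s w → lam (2 + s) (N ∷ w) ≡ replicate s E ++ N ∷ lam (2 + s) w
lam-N∷ s w = ++-assoc (replicate s E) (N ∷ []) (lam (2 + s) w)

lam-width+height : ∀ s a b → a + suc s * (a + b) ≡ suc s * a + s * b + (a + b)
lam-width+height = solve-∀

-- λ replaces each step by a run of east steps and one north step; the residue
-- returns to its old value (plus b for an E) exactly at that north step.
greedy-lam : ∀ s {a b d w} → d < a + b → Greedy a b d w →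
  Greedy (suc s * a + s * b) (a + b) d (lam (2 + s) w)
greedy-lam s _ done = done
greedy-lam s {a} {b} {d} _ (east {w = w} d<a g) =
  subst (Greedy (suc s * a + s * b) (a + b) d) (sym (lam-E∷ s w))
    (east-run (suc s) bound (north′ (residue s a b d) (greedy-lam s (+-monoˡ-< b d<a) g)))
  where
  bound : d + suc s * (a + b) < suc s * a + s * b + (a + b)
  bound = subst (d + suc s * (a + b) <_) (lam-width+height s a b) (+-monoˡ-< (suc s * (a + b)) d<a)
  residue : ∀ s a b d → d + suc s * (a + b) ≡ d + b + (suc s * a + s * b)
  residue = solve-∀
greedy-lam s {a} {b} d+a< (north {d} {w} g) =
  subst (Greedy (suc s * a + s * b) (a + b) (d + a)) (sym (lam-N∷ s w))
    (east-run s bound (north′ (residue s a b d) (greedy-lam s (m+n≤o⇒m≤o (suc d) d+a<) g)))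
  where
  bound : d + a + s * (a + b) < suc s * a + s * b + (a + b)
  bound = <-≤-trans (+-monoˡ-< (s * (a + b)) d+a<)
            (subst (suc s * (a + b) ≤_) (lam-width+height s a b) (m≤n+m _ a))
  residue : ∀ s a b d → d + a + s * (a + b) ≡ d + (suc s * a + s * b)
  residue = solve-∀

greedy-theta : ∀ {a b d w} → d < a + b → Greedy a b d w → Greedy (a + b) b d (theta w)
greedy-theta _ done = done
greedy-theta {a} {b} _ (east d<a g) =
  east (≤-trans d<a (m≤m+n a b)) (greedy-theta (+-monoˡ-< b d<a) g)
greedy-theta {a} {b} d+a< (north {d} g) =
  east d+a< (north′ (+-assoc d a b) (greedy-theta (m+n≤o⇒m≤o (suc d) d+a<) g))

-- Width and height of 𝒟_{m+3} for r = s + 2, i.e. c_{m+2} − c_{m+1} and c_{m+1}.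
widthD heightD : ℕ → ℕ → ℕ
widthD  s zero    = 1
widthD  s (suc m) = suc s * widthD s m + s * heightD s m
heightD s zero    = 0
heightD s (suc m) = widthD s m + heightD s m

christoffelD : ℕ → ℕ → Word
christoffelD s zero    = E ∷ []
christoffelD s (suc m) = lam (2 + s) (christoffelD s m)

c-via-widthD-heightD : ∀ s m →
  c (2 + s) (2 + m) ≡ widthD s m + heightD s m × c (2 + s) (1 + m) ≡ heightD s m
c-via-widthD-heightD s zero    = refl , refl
c-via-widthD-heightD s (suc m) with c-via-widthD-heightD s m
... | c₂≡w+h , c₁≡h = (begin
  (2 + s) * c (2 + s) (2 + m) ∸ c (2 + s) (1 + m) ≡⟨ cong₂ (λ p q → (2 + s) * p ∸ q) c₂≡w+h c₁≡h ⟩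
  (2 + s) * (w + h) ∸ h                           ≡⟨ cong (_∸ h) (identity s w h) ⟩
  widthD s (suc m) + heightD s (suc m) + h ∸ h    ≡⟨ m+n∸n≡m _ h ⟩
  widthD s (suc m) + heightD s (suc m)            ∎) , c₂≡w+h
  where
  open ≡-Reasoning
  w = widthD s m
  h = heightD s m
  identity : ∀ s w h → (2 + s) * (w + h) ≡ suc s * w + s * h + (w + h) + h
  identity = solve-∀

c-difference≡widthD : ∀ s m → c (2 + s) (2 + m) ∸ c (2 + s) (1 + m) ≡ widthD s m
c-difference≡widthD s m with c-via-widthD-heightD s m
... | c₂≡w+h , c₁≡h = trans (cong₂ _∸_ c₂≡w+h c₁≡h) (m+n∸n≡m (widthD s m) (heightD s m))

0<widthD : ∀ s m → 0 < widthD s m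
0<widthD s zero    = s≤s z≤n
0<widthD s (suc m) = ≤-trans (0<widthD s m) (≤-trans (m≤m+n _ _) (m≤m+n _ _))

christoffelD-greedy : ∀ s m →
  IsPath (widthD s m) (heightD s m) (christoffelD s m) ×
  Greedy (widthD s m) (heightD s m) 0 (christoffelD s m)
christoffelD-greedy s zero    = (refl , refl) , east (s≤s z≤n) done
christoffelD-greedy s (suc m) with christoffelD-greedy s m
... | path , g =
  isPath-lam s (christoffelD s m) path , greedy-lam s (≤-trans (0<widthD s m) (m≤m+n _ _)) g

D-maxDyck : ∀ s m →
  IsMaxDyck (c (2 + s) (2 + m) ∸ c (2 + s) (1 + m)) (c (2 + s) (1 + m)) (christoffelD s m)
D-maxDyck s m with christoffelD-greedy s m
... | path , g = subst₂ (λ a b → IsMaxDyck a b (christoffelD s m))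
  (sym (c-difference≡widthD s m)) (sym (proj₂ (c-via-widthD-heightD s m)))
  (greedy⇒maxDyck (≤-trans (0<widthD s m) (m≤m+n _ _)) path g)

C-maxDyck : ∀ s m → IsMaxDyck (c (2 + s) (2 + m)) (c (2 + s) (1 + m)) (theta (christoffelD s m))
C-maxDyck s m with christoffelD-greedy s m
... | path , g = subst₂ (λ a b → IsMaxDyck a b (theta (christoffelD s m)))
  (sym (proj₁ (c-via-widthD-heightD s m))) (sym (proj₂ (c-via-widthD-heightD s m)))
  (greedy⇒maxDyck 0<w+h+h (isPath-theta (christoffelD s m) path) (greedy-theta 0<w+h g))
  where
  0<w+h : 0 < widthD s m + heightD s m
  0<w+h = ≤-trans (0<widthD s m) (m≤m+n _ _)
  0<w+h+h : 0 < widthD s m + heightD s m + heightD s m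
  0<w+h+h = ≤-trans 0<w+h (m≤m+n _ _)

corollary4p11 : ∀ (r n : ℕ) → 2 ≤ r → 3 ≤ n →
  (∀ (w : Word) →
     IsMaxDyck (c r (n ∸ 1) ∸ c r (n ∸ 2)) (c r (n ∸ 2)) w →
     IsMaxDyck (c r n ∸ c r (n ∸ 1)) (c r (n ∸ 1)) (lam r w))
  × (∀ (w u : Word) →
     IsMaxDyck (c r (n ∸ 1)) (c r (n ∸ 2)) w → theta u ≡ w →
     IsMaxDyck (c r n) (c r (n ∸ 1)) (theta (lam r u)))
corollary4p11 (suc (suc s)) (suc (suc (suc m))) (s≤s (s≤s _)) (s≤s (s≤s (s≤s _))) =
  (λ w isD → subst (λ v → IsMaxDyck _ _ (lam (2 + s) v))
                   (sym (maxDyck-unique isD (D-maxDyck s m))) (D-maxDyck s (suc m))) ,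
  (λ w u isC θu≡w → subst (λ v → IsMaxDyck _ _ (theta (lam (2 + s) v)))
                   (sym (theta-injective u (christoffelD s m)
                          (trans θu≡w (maxDyck-unique isC (C-maxDyck s m)))))
                   (C-maxDyck s (suc m)))
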